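{- Let $A$ be an incomplete $n\times n$ similarity matrix. Then $A$ is Robinsonian if and only if there exists an ordering $\pi=(\pi_1,\dots,\pi_n)$ of $\{1,\dots,n\}$ such that for every $1\le j\le n-1$, the element $\pi_{j+1}$ is good for $\{\pi_1,\dots,\pi_j\}$.
   Context: An incomplete $n\times n$ similarity matrix is the similarity matrix of an incomplete weighted graph $G=(\{1,\dots,n\},E)$ with $w:E\to\mathbb{R}^+$: $A_{ij}=*$ (unspecified) if $i\neq j$ and $\{i,j\}\notin E$, $A_{ij}=w(\{i,j\})$ if $\{i,j\}\in E$, and $A_{ii}=\max_{e\in E}w(e)$. A (possibly incomplete) symmetric matrix $B$ is Robinson if for all integers $1\le i<l\le n$ and all $j,k\in[i,l]$ with $B_{il},B_{ij},B_{kl}$ all specified, $B_{il}\le\min\{B_{ij},B_{kl}\}$. $A$ is Robinsonian if there is a permutation $\pi$ of $\{1,\dots,n\}$ such that the matrix $A^\pi$ with entries $A^\pi_{ij}=A_{\pi_i\pi_j}$ is Robinson. Given a bipartition $\{V,U\}$ of $\{1,\dots,n\}$, an element $u\in U$ is good for $V$ if for all $k\in V$ and $p\in U$: ($A_{ku}\ne *$ and $A_{kp}\ne *$) implies $A_{ku}\ge A_{kp}$, and ($A_{pu}\ne*$ and $A_{pk}\ne *$) implies $A_{pu}\ge A_{pk}$. -}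

module Defs where

open import Level using (Level)
open import Data.Nat using (ℕ; zero; suc)
open import Data.Fin using (Fin; toℕ) renaming (_<_ to _<ᶠ_; _≤_ to _≤ᶠ_)
open import Data.Fin.Permutation using (Permutation′; _⟨$⟩ʳ_)
open import Data.Maybe using (Maybe; just; nothing)
open import Data.Product using (Σ; ∃; ∃-syntax; _×_; _,_)
open import Relation.Nullary using (¬_)
open import Relation.Binary.PropositionalEquality using (_≡_)
open import Relation.Binary.Bundles using (TotalOrder)

-- Weights live in an arbitrary totally ordered set W (e.g. the positive reals).
-- An incomplete matrix: 'nothing' = unspecified entry (*), 'just w' = specified.
module _ {c ℓ₁ ℓ₂ : Level} (W : TotalOrder c ℓ₁ ℓ₂) where
  open TotalOrder W renaming (Carrier to Wt)

  Matrix : ℕ → Set c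
  Matrix n = Fin n → Fin n → Maybe Wt

  record IsIncompleteSimilarity {n : ℕ} (A : Matrix n) : Set (c Level.⊔ ℓ₁ Level.⊔ ℓ₂) where
    field
      symmetric : ∀ i j → A i j ≡ A j i
      diagMax   : Wt
      diagEq    : ∀ i → A i i ≡ just diagMax
      diagUpper : ∀ i j → ¬ (i ≡ j) → ∀ w → A i j ≡ just w → w ≤ diagMax
      diagAttained : ∀ i j → ¬ (i ≡ j) → ∀ w → A i j ≡ just w →
                     ∃[ k ] ∃[ l ] (¬ (k ≡ l) × A k l ≡ just diagMax)

  IsRobinson : {n : ℕ} → Matrix n → Set (c Level.⊔ ℓ₂)
  IsRobinson {n} B =
    ∀ (i l j k : Fin n) → i <ᶠ l → i ≤ᶠ j → j ≤ᶠ l → i ≤ᶠ k → k ≤ᶠ l →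
    ∀ (a b d : Wt) → B i l ≡ just a → B i j ≡ just b → B k l ≡ just d →
    (a ≤ b) × (a ≤ d)

  permute : {n : ℕ} → Matrix n → Permutation′ n → Matrix n
  permute A π i j = A (π ⟨$⟩ʳ i) (π ⟨$⟩ʳ j)

  IsRobinsonian : {n : ℕ} → Matrix n → Set (c Level.⊔ ℓ₂)
  IsRobinsonian {n} A = ∃[ π ] IsRobinson (permute A π)

  -- Bipartition {V, U}: V given as a predicate, U its complement.
  -- u ∈ U is good for V.
  IsGood : {n : ℕ} → Matrix n → (V : Fin n → Set) → Fin n → Set (c Level.⊔ ℓ₂)
  IsGood {n} A V u =
    ¬ V u ×
    (∀ (k p : Fin n) → V k → ¬ V p →
      (∀ (a b : Wt) → A k u ≡ just a → A k p ≡ just b → b ≤ a) ×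
      (∀ (a b : Wt) → A p u ≡ just a → A p k ≡ just b → b ≤ a))

  -- {π_1, …, π_j}  (0-based: elements π i with toℕ i < j)
  prefixSet : {n : ℕ} → Permutation′ n → ℕ → Fin n → Set
  prefixSet π j x = ∃[ i ] (toℕ i Data.Nat.< j × π ⟨$⟩ʳ i ≡ x)

module Submission where

-- Fix an ordering π and write B = A^π.  Because the diagonal of a similarity
-- matrix is specified and dominates every entry, the Robinson condition on B
-- splits into two one-sided conditions, each comparing only TWO entries:
-- along each row, and along each column, entries can only decrease when
-- moving away from the diagonal.  On the other hand, "π m is good for
-- {π 0, …, π (m-1)}" says exactly that B a m ≽ B a b and B b m ≽ B b a
-- (an entry dominates another one whenever both are specified) for all
-- a < m ≤ b; we call this 'GoodAt B m'.

open import Defs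
open import Level using (Level; _⊔_)
open import Data.Nat using (ℕ; suc; _<_)
open import Data.Fin using (Fin; toℕ)
open import Data.Fin.Permutation using (Permutation′; _⟨$⟩ʳ_)
open import Data.Product using (∃-syntax)
open import Relation.Binary.Bundles using (TotalOrder)
open import Function.Bundles using (_⇔_)

import Data.Nat as ℕ
import Data.Nat.Properties as ℕₚ
open import Data.Fin using (fromℕ<) renaming (_<_ to _<ᶠ_; _≤_ to _≤ᶠ_)
open import Data.Fin.Properties using (toℕ<n; toℕ-fromℕ<; fromℕ<-toℕ; ≤∧≢⇒<; ≤-antisym)
open import Data.Fin.Permutation using (_⟨$⟩ˡ_; inverseˡ; inverseʳ)
open import Data.Maybe using (Maybe; just)
open import Data.Maybe.Properties using (just-injective)
open import Data.Product using (_,_; _×_; proj₁; proj₂)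
open import Data.Sum using (_⊎_; inj₁; inj₂)
open import Relation.Nullary using (¬_; yes; no)
open import Relation.Binary.PropositionalEquality
open import Function.Bundles using (mk⇔; Equivalence)

reindex : ∀ {p n} (P : ℕ → Fin n → Set p) →
  (∀ (j : ℕ) → 1 ℕ.≤ j → (jlt : suc j ℕ.≤ n) → P j (fromℕ< jlt)) ⇔
  (∀ (m : Fin n) → 1 ℕ.≤ toℕ m → P (toℕ m) m)
reindex P = mk⇔
  (λ f m 1≤m → subst (P (toℕ m)) (fromℕ<-toℕ m (toℕ<n m)) (f (toℕ m) 1≤m (toℕ<n m)))
  (λ g j 1≤j jlt → subst (λ j′ → P j′ (fromℕ< jlt)) (toℕ-fromℕ< jlt)
                      (g (fromℕ< jlt) (subst (1 ℕ.≤_) (sym (toℕ-fromℕ< jlt)) 1≤j)))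

endpoint-or-inside : ∀ {n} {i j l : Fin n} → i ≤ᶠ j → j ≤ᶠ l →
  i ≡ j ⊎ j ≡ l ⊎ (i <ᶠ j × j <ᶠ l)
endpoint-or-inside {i = i} {j} {l} i≤j j≤l with i Data.Fin.≟ j | j Data.Fin.≟ l
... | yes i≡j | _       = inj₁ i≡j
... | no _    | yes j≡l = inj₂ (inj₁ j≡l)
... | no i≢j  | no j≢l  = inj₂ (inj₂ (≤∧≢⇒< i≤j i≢j , ≤∧≢⇒< j≤l j≢l))

positive : ∀ {n} {i j : Fin n} → i <ᶠ j → 1 ℕ.≤ toℕ j
positive i<j = ℕₚ.≤-trans (ℕ.s≤s ℕ.z≤n) i<j

module _ {c ℓ₁ ℓ₂ : Level} (W : TotalOrder c ℓ₁ ℓ₂) where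
  open TotalOrder W using (_≤_) renaming (Carrier to Wt; refl to ≤-refl)

  _≽_ : Maybe Wt → Maybe Wt → Set (c ⊔ ℓ₂)
  x ≽ y = ∀ a b → x ≡ just a → y ≡ just b → b ≤ a

  ≽-refl : ∀ {x} → x ≽ x
  ≽-refl a b refl x≡b = subst (_≤ a) (just-injective x≡b) ≤-refl

  GoodAt : ∀ {n} → Matrix W n → Fin n → Set (c ⊔ ℓ₂)
  GoodAt B m = ∀ a b → a <ᶠ m → m ≤ᶠ b → (B a m ≽ B a b) × (B b m ≽ B b a)

  module RobinsonCriterion {n} (B : Matrix W n)
    (symmetric : ∀ i j → B i j ≡ B j i)
    (diagonal : ∀ i → ∃[ d ] B i i ≡ just d)
    (dominant : ∀ i j → B i i ≽ B i j) where

    RowsDecrease : Set (c ⊔ ℓ₂)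
    RowsDecrease = ∀ i j l → i ≤ᶠ j → j ≤ᶠ l → B i j ≽ B i l

    ColumnsDecrease : Set (c ⊔ ℓ₂)
    ColumnsDecrease = ∀ i k l → i ≤ᶠ k → k ≤ᶠ l → B k l ≽ B i l

    ≽-transpose : ∀ {i j k l} → B i j ≽ B k l → B j i ≽ B l k
    ≽-transpose {i} {j} {k} {l} ge a b e₁ e₂ =
      ge a b (trans (symmetric i j) e₁) (trans (symmetric k l) e₂)

    -- The unused third entry of a Robinson triple can be taken on the
    -- (specified) diagonal, so Robinson yields each one-sided condition.
    robinson⇒rows : IsRobinson W B → RowsDecrease
    robinson⇒rows R i j l i≤j j≤l b a e₁ e₂ with i Data.Fin.≟ l
    ... | yes refl = ≽-refl b a (subst (λ x → B i x ≡ just b) (sym (≤-antisym i≤j j≤l)) e₁) e₂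
    ... | no i≢l with diagonal l
    ...   | d , eₗ = proj₁ (R i l j l (≤∧≢⇒< (ℕₚ.≤-trans i≤j j≤l) i≢l) i≤j j≤l
                              (ℕₚ.≤-trans i≤j j≤l) ℕₚ.≤-refl a b d e₂ e₁ eₗ)

    robinson⇒columns : IsRobinson W B → ColumnsDecrease
    robinson⇒columns R i k l i≤k k≤l d a e₁ e₂ with i Data.Fin.≟ l
    ... | yes refl = ≽-refl d a (subst (λ x → B x i ≡ just d) (sym (≤-antisym i≤k k≤l)) e₁) e₂
    ... | no i≢l with diagonal i
    ...   | b , eᵢ = proj₂ (R i l i k (≤∧≢⇒< (ℕₚ.≤-trans i≤k k≤l) i≢l) ℕₚ.≤-refl
                              (ℕₚ.≤-trans i≤k k≤l) i≤k k≤l a b d e₂ eᵢ e₁)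

    rows×columns⇒robinson : RowsDecrease → ColumnsDecrease → IsRobinson W B
    rows×columns⇒robinson rows cols i l j k _ i≤j j≤l i≤k k≤l a b d e₁ e₂ e₃ =
      rows i j l i≤j j≤l b a e₂ e₁ , cols i k l i≤k k≤l d a e₃ e₁

    rows×columns⇒goodAt : RowsDecrease → ColumnsDecrease → ∀ m → GoodAt B m
    rows×columns⇒goodAt rows cols m a b a<m m≤b =
      rows a m b (ℕₚ.<⇒≤ a<m) m≤b , ≽-transpose (cols a m b (ℕₚ.<⇒≤ a<m) m≤b)

    -- A strictly inside middle index is handled by goodness at that index;
    -- the endpoints by reflexivity and diagonal dominance.
    goodAt⇒rows : (∀ m → 1 ℕ.≤ toℕ m → GoodAt B m) → RowsDecrease
    goodAt⇒rows good i j l i≤j j≤l with endpoint-or-inside i≤j j≤l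
    ... | inj₁ refl               = dominant i l
    ... | inj₂ (inj₁ refl)        = ≽-refl
    ... | inj₂ (inj₂ (i<j , j<l)) = proj₁ (good j (positive i<j) i l i<j (ℕₚ.<⇒≤ j<l))

    goodAt⇒columns : (∀ m → 1 ℕ.≤ toℕ m → GoodAt B m) → ColumnsDecrease
    goodAt⇒columns good i k l i≤k k≤l with endpoint-or-inside i≤k k≤l
    ... | inj₁ refl               = ≽-refl
    ... | inj₂ (inj₁ refl)        = ≽-transpose (dominant l i)
    ... | inj₂ (inj₂ (i<k , k<l)) =
      ≽-transpose (proj₂ (good k (positive i<k) i l i<k (ℕₚ.<⇒≤ k<l)))

    robinson⇔goodAt : IsRobinson W B ⇔ (∀ m → 1 ℕ.≤ toℕ m → GoodAt B m)
    robinson⇔goodAt = mk⇔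
      (λ R m _ → rows×columns⇒goodAt (robinson⇒rows R) (robinson⇒columns R) m)
      (λ good → rows×columns⇒robinson (goodAt⇒rows good) (goodAt⇒columns good))

  module _ {n} (A : Matrix W n) (π : Permutation′ n) where

    π-injective : ∀ {i j} → π ⟨$⟩ʳ i ≡ π ⟨$⟩ʳ j → i ≡ j
    π-injective e = trans (sym (inverseˡ π)) (trans (cong (π ⟨$⟩ˡ_) e) (inverseˡ π))

    inPrefix⇒< : ∀ {j a} → prefixSet W π j (π ⟨$⟩ʳ a) → toℕ a < j
    inPrefix⇒< {j} (i , i<j , e) = subst (λ x → toℕ x < j) (π-injective e) i<j

    good⇔goodAt : ∀ m → IsGood W A (prefixSet W π (toℕ m)) (π ⟨$⟩ʳ m) ⇔ GoodAt (permute W A π) m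
    good⇔goodAt m = mk⇔ to from
      where
      V = prefixSet W π (toℕ m)
      u = π ⟨$⟩ʳ m

      to : IsGood W A V u → GoodAt (permute W A π) m
      to (_ , good) a b a<m m≤b =
        good (π ⟨$⟩ʳ a) (π ⟨$⟩ʳ b) (a , a<m , refl)
             (λ b∈V → ℕₚ.<-irrefl refl (ℕₚ.<-≤-trans (inPrefix⇒< b∈V) m≤b))

      -- Every p outside V is π b for some b ≥ m.
      from : GoodAt (permute W A π) m → IsGood W A V u
      from good = (λ u∈V → ℕₚ.<-irrefl refl (inPrefix⇒< u∈V)) , goodFor
        where
        goodFor : ∀ k p → V k → ¬ V p → (A k u ≽ A k p) × (A p u ≽ A p k)
        goodFor .(π ⟨$⟩ʳ a) p (a , a<m , refl) p∉V =
          subst (λ x → (A (π ⟨$⟩ʳ a) u ≽ A (π ⟨$⟩ʳ a) x) × (A x u ≽ A x (π ⟨$⟩ʳ a)))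
                (inverseʳ π)
                (good a (π ⟨$⟩ˡ p) a<m
                  (ℕₚ.≮⇒≥ (λ b<m → p∉V (π ⟨$⟩ˡ p , b<m , inverseʳ π))))

  module _ {n} {A : Matrix W n} (S : IsIncompleteSimilarity W A) (π : Permutation′ n) where
    open IsIncompleteSimilarity S

    diagonal-dominant : ∀ i j → A i i ≽ A i j
    diagonal-dominant i j d w eᵢ eⱼ with i Data.Fin.≟ j
    ... | yes refl = ≽-refl d w eᵢ eⱼ
    ... | no i≢j   = subst (w ≤_) (just-injective (trans (sym (diagEq i)) eᵢ))
                       (diagUpper i j i≢j w eⱼ)

    open RobinsonCriterion (permute W A π)
      (λ i j → symmetric (π ⟨$⟩ʳ i) (π ⟨$⟩ʳ j))
      (λ i → diagMax , diagEq (π ⟨$⟩ʳ i))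
      (λ i j → diagonal-dominant (π ⟨$⟩ʳ i) (π ⟨$⟩ʳ j))
      public using (robinson⇔goodAt)

lemma6p4 : {c ℓ₁ ℓ₂ : Level} (W : TotalOrder c ℓ₁ ℓ₂) (n : ℕ) (A : Matrix W n) →
    IsIncompleteSimilarity W A →
    IsRobinsonian W A ⇔
      (∃[ π ] (∀ (j : ℕ) → 1 Data.Nat.≤ j → (jlt : suc j Data.Nat.≤ n) →
        IsGood W A (prefixSet W π j) (π ⟨$⟩ʳ Data.Fin.fromℕ< jlt)))
lemma6p4 {c} {ℓ₂ = ℓ₂} W n A S = mk⇔
  (λ { (π , R) → π , from (reindex (Good π)) (λ m 1≤m →
       from (good⇔goodAt W A π m) (to (robinson⇔goodAt W S π) R m 1≤m)) })
  (λ { (π , G) → π , from (robinson⇔goodAt W S π) (λ m 1≤m →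
       to (good⇔goodAt W A π m) (to (reindex (Good π)) G m 1≤m)) })
  where
  open Equivalence
  Good : Permutation′ n → ℕ → Fin n → Set (c ⊔ ℓ₂)
  Good π j m = IsGood W A (prefixSet W π j) (π ⟨$⟩ʳ m)
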